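{- Let $G_0$ be a connected graph with at least two vertices, and let $u,w$ be two distinct vertices of $G_0$. Let $C_1$ and $C_2$ be cycles, vertex-disjoint from each other and from $G_0$, and let $H_5$ be the graph obtained from $G_0\cup C_1\cup C_2$ by identifying some vertex of $C_1$ with $u$ and some vertex of $C_2$ with $w$. Let $v_1,v_2$ be the two neighbours of $w$ on $C_2$, let $v_0$ be the neighbour of $v_2$ on $C_2$ other than $w$, and let $u_1u_2$ be an edge of $C_1$. Let $H_6=H_5-\{v_1w,\,v_0v_2,\,u_1u_2\}+\{u_1v_0,\,u_2v_1\}$. Then $M_i(H_6)<M_i(H_5)$ for $i=1,2$.
   Context: All graphs are finite and simple. For a graph $G$ with vertex degrees $d(u)$, $M_1(G)=\sum_{u\in V(G)} d(u)^2$ and $M_2(G)=\sum_{uv\in E(G)} d(u)d(v)$. $H-F+F'$ denotes the graph obtained from $H$ by deleting the edge set $F$ and adding the edge set $F'$. -}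

module Defs where

open import Data.Nat using (ℕ; zero; suc; _+_; _*_; _≤_; _<_)
open import Data.Nat.Properties using ()
open import Data.Bool using (Bool; true; false; _∧_; _∨_; not; if_then_else_)
open import Data.Fin using (Fin; zero; suc; toℕ; fromℕ; inject₁; _↑ˡ_; _↑ʳ_; _≟_; _<?_)
open import Data.List using (List; []; _∷_; [_]; _++_; map; concatMap; allFin)
open import Data.Nat.ListAction using (sum)
open import Data.Bool.ListAction using (any)
open import Data.Product using (_×_; _,_)
open import Relation.Nullary.Decidable using (⌊_⌋)
open import Relation.Binary.PropositionalEquality using (_≡_)

record Graph (n : ℕ) : Set where
  field
    adj    : Fin n → Fin n → Bool
    sym    : ∀ x y → adj x y ≡ adj y x
    irrefl : ∀ x → adj x x ≡ false
open Graph public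

Adj : ℕ → Set
Adj n = Fin n → Fin n → Bool

data Reach {n : ℕ} (G : Graph n) : Fin n → Fin n → Set where
  here : ∀ {x} → Reach G x x
  step : ∀ {x y z} → adj G x y ≡ true → Reach G y z → Reach G x z

Connected : {n : ℕ} → Graph n → Set
Connected {n} G = ∀ (x y : Fin n) → Reach G x y

deg : {n : ℕ} → Adj n → Fin n → ℕ
deg {n} A x = sum (map (λ y → if A x y then 1 else 0) (allFin n))

M₁ : {n : ℕ} → Adj n → ℕ
M₁ {n} A = sum (map (λ x → deg A x * deg A x) (allFin n))

-- sum over edges xy (each unordered edge counted once, via toℕ x < toℕ y)
M₂ : {n : ℕ} → Adj n → ℕ
M₂ {n} A = sum (map (λ x → sum (map (λ y →
  if A x y ∧ ⌊ x <? y ⌋ then deg A x * deg A y else 0) (allFin n))) (allFin n))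

Edge : ℕ → Set
Edge n = Fin n × Fin n

edgeAdj : {n : ℕ} → List (Edge n) → Adj n
edgeAdj es x y = any (λ { (p , q) → (⌊ p ≟ x ⌋ ∧ ⌊ q ≟ y ⌋) ∨ (⌊ p ≟ y ⌋ ∧ ⌊ q ≟ x ⌋) }) es

-- edges of the cycle f 0 - f 1 - ... - f m - f 0 (length m+1)
cycleEdges : {N m : ℕ} → (Fin (suc m) → Fin N) → List (Edge N)
cycleEdges {N} {m} f = (f (fromℕ m) , f zero) ∷ map (λ i → (f (inject₁ i) , f (suc i))) (allFin m)

modify : {n : ℕ} → Adj n → List (Edge n) → List (Edge n) → Adj n
modify A F F' x y = (A x y ∧ not (edgeAdj F x y)) ∨ edgeAdj F' x y

-- Vertex set: Fin (n + ((2 + a) + (2 + b))):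
--   the n vertices of G0, the 2+a vertices of C1 other than u,
--   the 2+b vertices of C2 other than w.
-- C1 has length 3+a, C2 has length 3+b (cycles have length ≥ 3).

module Construction {n : ℕ} (G₀ : Graph n) (u w : Fin n) (a b : ℕ) where

  N : ℕ
  N = n + ((2 + a) + (2 + b))

  g : Fin n → Fin N
  g i = i ↑ˡ ((2 + a) + (2 + b))

  c₁ : Fin (2 + a) → Fin N
  c₁ j = n ↑ʳ (j ↑ˡ (2 + b))

  c₂ : Fin (2 + b) → Fin N
  c₂ j = n ↑ʳ ((2 + a) ↑ʳ j)

  p₁ : Fin (3 + a) → Fin N
  p₁ zero    = g u
  p₁ (suc j) = c₁ j

  p₂ : Fin (3 + b) → Fin N
  p₂ zero    = g w
  p₂ (suc j) = c₂ j

  G₀edges : List (Edge N)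
  G₀edges = concatMap (λ i → concatMap (λ j →
    if adj G₀ i j then [ (g i , g j) ] else []) (allFin n)) (allFin n)

  C₁edges : List (Edge N)
  C₁edges = cycleEdges {N} {2 + a} p₁

  C₂edges : List (Edge N)
  C₂edges = cycleEdges {N} {2 + b} p₂

  H₅ : Adj N
  H₅ = edgeAdj (G₀edges ++ C₁edges ++ C₂edges)

  v₁ v₂ : Fin N
  v₁ = p₂ (suc zero)
  v₂ = p₂ (fromℕ (2 + b))
  v₀ : Fin N
  v₀ = p₂ (inject₁ (fromℕ (1 + b)))

  H₆ : (u₁ u₂ : Fin N) → Adj N
  H₆ u₁ u₂ = modify H₅ ((v₁ , g w) ∷ (v₀ , v₂) ∷ (u₁ , u₂) ∷ [])
                       ((u₁ , v₀) ∷ (u₂ , v₁) ∷ [])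

-- Write d and d′ for the degrees in H₅ and H₆. Deleting v₁w, v₀v₂, u₁u₂ and adding u₁v₀, u₂v₁
-- lowers the degrees of w and v₂ and raises none, so d′ ≤ d with d′(w) < d(w), hence M₁ drops.
-- For M₂, every common edge contributes d′(x)d′(y) ≤ d(x)d(y); the deleted edges contribute
-- d(v₁)d(w) + d(v₀)d(v₂) + xy ≥ 8 + xy with x = d(u₁), y = d(u₂) ≥ 2, while the added ones
-- contribute at most 2x + 2y ≤ xy + 4, because v₀ and v₁ are inner vertices of C₂ of degree 2.
-- Degrees and M₂ are both treated as weighted sums Σ_{A x y} W x y over ordered adjacent pairs,
-- which split exactly along a list of distinct non-loop edges.

module Submission where

open import Defs hiding (sym)
open import Data.Bool using (Bool; true; false; _∧_; _∨_; not; if_then_else_)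
open import Data.Bool.Properties using (∨-comm; ∨-zeroʳ; ∧-comm)
open import Data.Empty using (⊥; ⊥-elim)
open import Data.Fin using (Fin; zero; suc; toℕ; fromℕ; inject₁; _↑ˡ_; _↑ʳ_; _≟_; _<?_; splitAt)
open import Data.Fin.Properties
  using (toℕ-inject₁; fromℕ≢inject₁; ↑ˡ-injective; ↑ʳ-injective; splitAt-↑ˡ; splitAt-↑ʳ; <-asym; toℕ-injective)
open import Data.List using (List; []; _∷_; _++_; map; allFin)
open import Data.List.Properties using (map-tabulate; map-∘; map-++)
open import Data.List.Membership.Propositional using (_∈_; find; lose)
open import Data.List.Membership.Propositional.Properties using (∈-concatMap⁻; ∈-map⁻; ∈-allFin; ∈-map⁺)
open import Data.List.Relation.Unary.All using (All; []; _∷_; lookupWith)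
open import Data.List.Relation.Unary.All.Properties using (All¬⇒¬Any)
open import Data.List.Relation.Unary.Any as Any using (Any; here; there; satisfied)
open import Data.List.Relation.Unary.Any.Properties using (++⁺ˡ; ++⁺ʳ)
open import Data.Nat using (ℕ; zero; suc; _+_; _*_; _≤_; _<_; z≤n; s≤s)
open import Data.Nat.ListAction using (sum)
open import Data.Nat.ListAction.Properties using (sum-++)
open import Data.Nat.Properties hiding (_≟_; _<?_; <-asym)
open import Data.Nat.Tactic.RingSolver using (solve-∀)
open import Algebra.Properties.CommutativeSemigroup +-commutativeSemigroup using (interchange)
open import Data.Product using (_×_; _,_; proj₁; proj₂; ∃; ∃₂; swap; uncurry)
open import Data.Sum using (_⊎_; inj₁; inj₂)
open import Data.Unit using (⊤; tt)
open import Function using (_∘_; id)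
open import Relation.Nullary using (¬_; yes; no)
open import Relation.Nullary.Decidable using (Dec; ⌊_⌋; ⌊⌋-map′; isYes≗does; dec-true; dec-false)
open import Relation.Binary.PropositionalEquality

⌊⌋-yes : ∀ {P : Set} (P? : Dec P) → P → ⌊ P? ⌋ ≡ true
⌊⌋-yes P? p = trans (isYes≗does P?) (dec-true P? p)

⌊⌋-no : ∀ {P : Set} (P? : Dec P) → ¬ P → ⌊ P? ⌋ ≡ false
⌊⌋-no P? ¬p = trans (isYes≗does P?) (dec-false P? ¬p)

≟-sym : ∀ {N} (x y : Fin N) → ⌊ x ≟ y ⌋ ≡ ⌊ y ≟ x ⌋
≟-sym x y with x ≟ y
... | yes refl = sym (⌊⌋-yes (x ≟ x) refl)
... | no x≢y   = sym (⌊⌋-no (y ≟ x) (x≢y ∘ sym))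

when : Bool → ℕ → ℕ
when b v = if b then v else 0

when-∧ : ∀ a b v → when (a ∧ b) v ≡ when a (when b v)
when-∧ true  b v = refl
when-∧ false b v = refl

when-0 : ∀ a → when a 0 ≡ 0
when-0 true  = refl
when-0 false = refl

when-∨-≤ : ∀ a b v → when (a ∨ b) v ≤ when a v + when b v
when-∨-≤ true  b v = m≤m+n v _
when-∨-≤ false b v = ≤-refl

when-∨ : ∀ a b v → (a ≡ true → b ≡ true → ⊥) → when (a ∨ b) v ≡ when a v + when b v
when-∨ true  true  v disjoint = ⊥-elim (disjoint refl refl)
when-∨ true  false v disjoint = sym (+-identityʳ v)
when-∨ false b     v disjoint = refl

when-mono : ∀ b {v v′} → v ≤ v′ → when b v ≤ when b v′
when-mono true  v≤v′ = v≤v′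
when-mono false _    = z≤n

when-modify : ∀ a f f′ {v v′} → (f ≡ true → a ≡ true) → v′ ≤ v →
              when ((a ∧ not f) ∨ f′) v′ + when f v ≤ when a v + when f′ v′
when-modify true  true  true  {v} {v′} _   _    = ≤-reflexive (+-comm v′ v)
when-modify true  true  false {v} {v′} _   _    = ≤-reflexive (+-comm 0 v)
when-modify true  false true  {v} {v′} _   v′≤v = +-mono-≤ v′≤v z≤n
when-modify true  false false {v} {v′} _   v′≤v = +-mono-≤ v′≤v ≤-refl
when-modify false true  _     {v} {v′} f⇒a _    with () ← f⇒a refl
when-modify false false true  {v} {v′} _   _    = ≤-reflexive (+-comm v′ 0)
when-modify false false false {v} {v′} _   _    = z≤n

square-+1 : ∀ {a c} → a + 1 ≤ c → a * a + 1 ≤ c * c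
square-+1 {a} {c} a+1≤c = begin
  a * a + 1     ≡⟨ +-comm (a * a) 1 ⟩
  suc (a * a)   ≤⟨ s≤s (≤-trans (*-monoʳ-≤ a (n≤1+n a)) (m≤n+m (a * suc a) a)) ⟩
  suc a * suc a ≤⟨ *-mono-≤ 1+a≤c 1+a≤c ⟩
  c * c         ∎
  where
  open ≤-Reasoning
  1+a≤c : suc a ≤ c
  1+a≤c = subst (_≤ c) (+-comm a 1) a+1≤c

square-+when : ∀ b {a c} → a + when b 1 ≤ c → a * a + when b 1 ≤ c * c
square-+when true  = square-+1
square-+when false {a} {c} a+0≤c = subst (_≤ c * c) (sym (+-identityʳ (a * a))) (*-mono-≤ a≤c a≤c)
  where
  a≤c : a ≤ c
  a≤c = subst (_≤ c) (+-identityʳ a) a+0≤c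

module _ {X : Set} where

  sum-map-mono : ∀ (xs : List X) {f g : X → ℕ} → (∀ x → f x ≤ g x) → sum (map f xs) ≤ sum (map g xs)
  sum-map-mono []       f≤g = z≤n
  sum-map-mono (x ∷ xs) f≤g = +-mono-≤ (f≤g x) (sum-map-mono xs f≤g)

  sum-map-cong : ∀ (xs : List X) {f g : X → ℕ} → (∀ x → f x ≡ g x) → sum (map f xs) ≡ sum (map g xs)
  sum-map-cong []       f≗g = refl
  sum-map-cong (x ∷ xs) f≗g = cong₂ _+_ (f≗g x) (sum-map-cong xs f≗g)

  sum-map-+ : ∀ (xs : List X) (f g : X → ℕ) →
              sum (map (λ x → f x + g x) xs) ≡ sum (map f xs) + sum (map g xs)
  sum-map-+ []       f g = refl
  sum-map-+ (x ∷ xs) f g = trans (cong (f x + g x +_) (sum-map-+ xs f g)) (interchange (f x) (g x) _ _)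

  sum-map-zero : ∀ (xs : List X) → sum (map (λ _ → 0) xs) ≡ 0
  sum-map-zero []       = refl
  sum-map-zero (x ∷ xs) = sum-map-zero xs

∑ : {N : ℕ} → (Fin N → ℕ) → ℕ
∑ {N} f = sum (map f (allFin N))

module _ {N : ℕ} where

  ∑-mono : {f g : Fin N → ℕ} → (∀ x → f x ≤ g x) → ∑ f ≤ ∑ g
  ∑-mono = sum-map-mono (allFin N)

  ∑-cong : {f g : Fin N → ℕ} → (∀ x → f x ≡ g x) → ∑ f ≡ ∑ g
  ∑-cong = sum-map-cong (allFin N)

  ∑-+ : (f g : Fin N → ℕ) → ∑ (λ x → f x + g x) ≡ ∑ f + ∑ g
  ∑-+ = sum-map-+ (allFin N)

  ∑-zero : ∑ {N} (λ _ → 0) ≡ 0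
  ∑-zero = sum-map-zero (allFin N)

  ∑-when : ∀ b (f : Fin N → ℕ) → ∑ (λ x → when b (f x)) ≡ when b (∑ f)
  ∑-when true  f = refl
  ∑-when false f = ∑-zero

∑-suc : ∀ {N} (f : Fin (suc N) → ℕ) → ∑ f ≡ f zero + ∑ (f ∘ suc)
∑-suc f = cong (λ xs → f zero + sum xs) (trans (map-tabulate suc f) (sym (map-tabulate id (f ∘ suc))))

∑-init-last : ∀ {N} (f : Fin (suc N) → ℕ) → ∑ f ≡ ∑ (f ∘ inject₁) + f (fromℕ N)
∑-init-last {zero}  f = trans (∑-suc f) (+-comm (f zero) 0)
∑-init-last {suc N} f = begin
  ∑ f                                                ≡⟨ ∑-suc f ⟩
  f zero + ∑ (f ∘ suc)                               ≡⟨ cong (f zero +_) (∑-init-last (f ∘ suc)) ⟩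
  f zero + (∑ (f ∘ suc ∘ inject₁) + f (fromℕ (suc N))) ≡⟨ +-assoc (f zero) _ _ ⟨
  f zero + ∑ (f ∘ suc ∘ inject₁) + f (fromℕ (suc N))   ≡⟨ cong (_+ f (fromℕ (suc N))) (∑-suc (f ∘ inject₁)) ⟨
  ∑ (f ∘ inject₁) + f (fromℕ (suc N))                  ∎
  where open ≡-Reasoning

∑-single : ∀ {N} (p : Fin N) (f : Fin N → ℕ) → ∑ (λ x → when ⌊ p ≟ x ⌋ (f x)) ≡ f p
∑-single {suc N} zero    f = begin
  ∑ (λ x → when ⌊ zero ≟ x ⌋ (f x)) ≡⟨ ∑-suc (λ x → when ⌊ zero ≟ x ⌋ (f x)) ⟩
  f zero + ∑ {N} (λ _ → 0)           ≡⟨ cong (f zero +_) (∑-zero {N}) ⟩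
  f zero + 0                         ≡⟨ +-identityʳ (f zero) ⟩
  f zero                             ∎
  where open ≡-Reasoning
∑-single {suc N} (suc p) f = begin
  ∑ (λ x → when ⌊ suc p ≟ x ⌋ (f x))            ≡⟨ ∑-suc (λ x → when ⌊ suc p ≟ x ⌋ (f x)) ⟩
  ∑ (λ x → when ⌊ suc p ≟ suc x ⌋ (f (suc x)))  ≡⟨ ∑-cong (λ x → cong (λ b → when b (f (suc x))) (⌊⌋-map′ _ _ (p ≟ x))) ⟩
  ∑ (λ x → when ⌊ p ≟ x ⌋ (f (suc x)))          ≡⟨ ∑-single p (f ∘ suc) ⟩
  f (suc p)                                    ∎
  where open ≡-Reasoning

∨⁻ : ∀ a {b} → a ∨ b ≡ true → a ≡ true ⊎ b ≡ true
∨⁻ true  _ = inj₁ refl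
∨⁻ false h = inj₂ h

module _ {N : ℕ} where

  _⊆_ : Adj N → Adj N → Set
  A ⊆ B = ∀ x y → A x y ≡ true → B x y ≡ true

  Joins : Edge N → Fin N → Fin N → Set
  Joins (p , q) x y = (p ≡ x × q ≡ y) ⊎ (p ≡ y × q ≡ x)

  Joins-trans : ∀ {e p q x y} → Joins e x y → Joins (p , q) x y → Joins e p q
  Joins-trans {_ , _} (inj₁ (refl , refl)) (inj₁ (refl , refl)) = inj₁ (refl , refl)
  Joins-trans {_ , _} (inj₁ (refl , refl)) (inj₂ (refl , refl)) = inj₂ (refl , refl)
  Joins-trans {_ , _} (inj₂ (refl , refl)) (inj₁ (refl , refl)) = inj₂ (refl , refl)
  Joins-trans {_ , _} (inj₂ (refl , refl)) (inj₂ (refl , refl)) = inj₁ (refl , refl)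

  ¬Joins : ∀ {p q x y} → p ≢ y → q ≢ y → ¬ Joins (p , q) x y
  ¬Joins p≢y q≢y (inj₁ (_ , q≡y)) = q≢y q≡y
  ¬Joins p≢y q≢y (inj₂ (p≡y , _)) = p≢y p≡y

  Joins-adj : {A : Adj N} → (∀ x y → A x y ≡ A y x) →
              ∀ {e x y} → A (proj₁ e) (proj₂ e) ≡ true → Joins e x y → A x y ≡ true
  Joins-adj A-sym Ae (inj₁ (refl , refl)) = Ae
  Joins-adj A-sym Ae (inj₂ (refl , refl)) = trans (A-sym _ _) Ae

  arc : Fin N → Fin N → Adj N
  arc p q x y = ⌊ p ≟ x ⌋ ∧ ⌊ q ≟ y ⌋

  arc⁻ : ∀ {p q x y} → arc p q x y ≡ true → p ≡ x × q ≡ y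
  arc⁻ {p} {q} {x} {y} h with p ≟ x | q ≟ y | h
  ... | yes p≡x | yes q≡y | _  = p≡x , q≡y
  ... | yes _   | no _    | ()
  ... | no _    | _       | ()

  arc-refl : ∀ p q → arc p q p q ≡ true
  arc-refl p q = cong₂ _∧_ (⌊⌋-yes (p ≟ p) refl) (⌊⌋-yes (q ≟ q) refl)

  arcs⁻ : ∀ {p q x y} → arc p q x y ∨ arc q p x y ≡ true → Joins (p , q) x y
  arcs⁻ {p} {q} {x} {y} h with ∨⁻ (arc p q x y) h
  ... | inj₁ pq = inj₁ (arc⁻ pq)
  ... | inj₂ qp = inj₂ (swap (arc⁻ qp))

  arcs⁺ : ∀ {p q x y} → Joins (p , q) x y → arc p q x y ∨ arc q p x y ≡ true
  arcs⁺ {p} {q} (inj₁ (refl , refl)) = cong (_∨ arc q p p q) (arc-refl p q)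
  arcs⁺ {p} {q} (inj₂ (refl , refl)) = trans (cong (arc p q q p ∨_) (arc-refl q p)) (∨-zeroʳ _)

  edgeAdj-∷ : ∀ p q L x y → edgeAdj ((p , q) ∷ L) x y ≡ (arc p q x y ∨ arc q p x y) ∨ edgeAdj L x y
  edgeAdj-∷ p q L x y = cong (λ b → (arc p q x y ∨ b) ∨ edgeAdj L x y) (∧-comm ⌊ p ≟ y ⌋ ⌊ q ≟ x ⌋)

  edgeAdj-sym : ∀ (L : List (Edge N)) x y → edgeAdj L x y ≡ edgeAdj L y x
  edgeAdj-sym []            x y = refl
  edgeAdj-sym ((p , q) ∷ L) x y =
    cong₂ _∨_ (∨-comm (⌊ p ≟ x ⌋ ∧ ⌊ q ≟ y ⌋) (⌊ p ≟ y ⌋ ∧ ⌊ q ≟ x ⌋)) (edgeAdj-sym L x y)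

  edgeAdj⁻ : ∀ (L : List (Edge N)) {x y} → edgeAdj L x y ≡ true → Any (λ e → Joins e x y) L
  edgeAdj⁻ ((p , q) ∷ L) {x} {y} h
    with ∨⁻ (arc p q x y ∨ arc q p x y) (trans (sym (edgeAdj-∷ p q L x y)) h)
  ... | inj₁ pq = here (arcs⁻ pq)
  ... | inj₂ L∋ = there (edgeAdj⁻ L L∋)

  edgeAdj⁺ : ∀ (L : List (Edge N)) {x y} → Any (λ e → Joins e x y) L → edgeAdj L x y ≡ true
  edgeAdj⁺ ((p , q) ∷ L) {x} {y} (here j) =
    trans (edgeAdj-∷ p q L x y) (cong (_∨ edgeAdj L x y) (arcs⁺ j))
  edgeAdj⁺ ((p , q) ∷ L) {x} {y} (there a) =
    trans (edgeAdj-∷ p q L x y) (trans (cong (_ ∨_) (edgeAdj⁺ L a)) (∨-zeroʳ _))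

  edgeAdj-⊆ : ∀ {A : Adj N} (F : List (Edge N)) → (∀ x y → A x y ≡ A y x) →
              All (λ e → A (proj₁ e) (proj₂ e) ≡ true) F →
              edgeAdj F ⊆ A
  edgeAdj-⊆ F A-sym F⊆A x y h = lookupWith (λ Ae j → Joins-adj A-sym Ae j) F⊆A (edgeAdj⁻ F h)

  Simple : List (Edge N) → Set
  Simple []            = ⊤
  Simple ((p , q) ∷ L) = p ≢ q × All (λ e → ¬ Joins e p q) L × Simple L

  weight : Adj N → (Fin N → Fin N → ℕ) → ℕ
  weight A W = ∑ λ x → ∑ λ y → when (A x y) (W x y)

  listWeight : List (Edge N) → (Fin N → Fin N → ℕ) → ℕ
  listWeight L W = sum (map (λ e → W (proj₁ e) (proj₂ e) + W (proj₂ e) (proj₁ e)) L)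

  listWeight-++ : ∀ (L L′ : List (Edge N)) W → listWeight (L ++ L′) W ≡ listWeight L W + listWeight L′ W
  listWeight-++ L L′ W = trans (cong sum (map-++ term L L′)) (sum-++ (map term L) (map term L′))
    where
    term : Edge N → ℕ
    term e = W (proj₁ e) (proj₂ e) + W (proj₂ e) (proj₁ e)

  ∑∑-+ : (f g : Fin N → Fin N → ℕ) →
         (∑ λ x → ∑ λ y → f x y + g x y) ≡ (∑ λ x → ∑ (f x)) + (∑ λ x → ∑ (g x))
  ∑∑-+ f g = trans (∑-cong (λ x → ∑-+ (f x) (g x))) (∑-+ (λ x → ∑ (f x)) (λ x → ∑ (g x)))

  weight-cong : ∀ {A B : Adj N} W → (∀ x y → A x y ≡ B x y) → weight A W ≡ weight B W
  weight-cong W A≗B = ∑-cong λ x → ∑-cong λ y → cong (λ b → when b (W x y)) (A≗B x y)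

  weight-∨-≤ : ∀ (A B : Adj N) W → weight (λ x y → A x y ∨ B x y) W ≤ weight A W + weight B W
  weight-∨-≤ A B W = ≤-trans
    (∑-mono λ x → ∑-mono λ y → when-∨-≤ (A x y) (B x y) (W x y))
    (≤-reflexive (∑∑-+ (λ x y → when (A x y) (W x y)) (λ x y → when (B x y) (W x y))))

  weight-∨ : ∀ (A B : Adj N) W → (∀ x y → A x y ≡ true → B x y ≡ true → ⊥) →
             weight (λ x y → A x y ∨ B x y) W ≡ weight A W + weight B W
  weight-∨ A B W disjoint = trans
    (∑-cong λ x → ∑-cong λ y → when-∨ (A x y) (B x y) (W x y) (disjoint x y))
    (∑∑-+ (λ x y → when (A x y) (W x y)) (λ x y → when (B x y) (W x y)))

  weight-arc : ∀ p q W → weight (arc p q) W ≡ W p q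
  weight-arc p q W = trans (∑-cong row) (∑-single p (λ x → W x q))
    where
    row : ∀ x → (∑ λ y → when (arc p q x y) (W x y)) ≡ when ⌊ p ≟ x ⌋ (W x q)
    row x = begin
      (∑ λ y → when (arc p q x y) (W x y))             ≡⟨ ∑-cong (λ y → when-∧ ⌊ p ≟ x ⌋ ⌊ q ≟ y ⌋ (W x y)) ⟩
      (∑ λ y → when ⌊ p ≟ x ⌋ (when ⌊ q ≟ y ⌋ (W x y))) ≡⟨ ∑-when ⌊ p ≟ x ⌋ (λ y → when ⌊ q ≟ y ⌋ (W x y)) ⟩
      when ⌊ p ≟ x ⌋ (∑ λ y → when ⌊ q ≟ y ⌋ (W x y))   ≡⟨ cong (when ⌊ p ≟ x ⌋) (∑-single q (W x)) ⟩
      when ⌊ p ≟ x ⌋ (W x q)                            ∎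
      where open ≡-Reasoning

  weight-edge-≤ : ∀ p q W → weight (λ x y → arc p q x y ∨ arc q p x y) W ≤ W p q + W q p
  weight-edge-≤ p q W = ≤-trans (weight-∨-≤ (arc p q) (arc q p) W)
                                (≤-reflexive (cong₂ _+_ (weight-arc p q W) (weight-arc q p W)))

  weight-edge : ∀ {p q} W → p ≢ q → weight (λ x y → arc p q x y ∨ arc q p x y) W ≡ W p q + W q p
  weight-edge {p} {q} W p≢q = trans (weight-∨ (arc p q) (arc q p) W opposite)
                                    (cong₂ _+_ (weight-arc p q W) (weight-arc q p W))
    where
    opposite : ∀ x y → arc p q x y ≡ true → arc q p x y ≡ true → ⊥
    opposite x y pq qp = p≢q (trans (proj₁ (arc⁻ pq)) (sym (proj₁ (arc⁻ qp))))

  weight-edgeAdj-≤ : ∀ (L : List (Edge N)) W → weight (edgeAdj L) W ≤ listWeight L W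
  weight-edgeAdj-≤ []            W = ≤-reflexive (trans (∑-cong {N} (λ _ → ∑-zero {N})) (∑-zero {N}))
  weight-edgeAdj-≤ ((p , q) ∷ L) W = begin
    weight (edgeAdj ((p , q) ∷ L)) W
      ≡⟨ weight-cong W (edgeAdj-∷ p q L) ⟩
    weight (λ x y → (arc p q x y ∨ arc q p x y) ∨ edgeAdj L x y) W
      ≤⟨ weight-∨-≤ _ (edgeAdj L) W ⟩
    weight (λ x y → arc p q x y ∨ arc q p x y) W + weight (edgeAdj L) W
      ≤⟨ +-mono-≤ (weight-edge-≤ p q W) (weight-edgeAdj-≤ L W) ⟩
    listWeight ((p , q) ∷ L) W ∎
    where open ≤-Reasoning

  weight-edgeAdj : ∀ (L : List (Edge N)) W → Simple L → weight (edgeAdj L) W ≡ listWeight L W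
  weight-edgeAdj []            W _ = trans (∑-cong {N} (λ _ → ∑-zero {N})) (∑-zero {N})
  weight-edgeAdj ((p , q) ∷ L) W (p≢q , new , simple) = begin
    weight (edgeAdj ((p , q) ∷ L)) W
      ≡⟨ weight-cong W (edgeAdj-∷ p q L) ⟩
    weight (λ x y → (arc p q x y ∨ arc q p x y) ∨ edgeAdj L x y) W
      ≡⟨ weight-∨ _ (edgeAdj L) W not-in-L ⟩
    weight (λ x y → arc p q x y ∨ arc q p x y) W + weight (edgeAdj L) W
      ≡⟨ cong₂ _+_ (weight-edge W p≢q) (weight-edgeAdj L W simple) ⟩
    listWeight ((p , q) ∷ L) W ∎
    where
    open ≡-Reasoning
    not-in-L : ∀ x y → arc p q x y ∨ arc q p x y ≡ true → edgeAdj L x y ≡ true → ⊥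
    not-in-L x y pq L∋ = All¬⇒¬Any new (Any.map (λ j → Joins-trans j (arcs⁻ pq)) (edgeAdj⁻ L L∋))

  weight-modify : ∀ (A : Adj N) F F′ {W W′ : Fin N → Fin N → ℕ} →
                  edgeAdj F ⊆ A → (∀ x y → W′ x y ≤ W x y) →
                  weight (modify A F F′) W′ + weight (edgeAdj F) W ≤ weight A W + weight (edgeAdj F′) W′
  weight-modify A F F′ {W} {W′} F⊆A W′≤W = begin
    weight (modify A F F′) W′ + weight (edgeAdj F) W
      ≡⟨ ∑∑-+ (λ x y → when (modify A F F′ x y) (W′ x y)) (λ x y → when (edgeAdj F x y) (W x y)) ⟨
    (∑ λ x → ∑ λ y → when (modify A F F′ x y) (W′ x y) + when (edgeAdj F x y) (W x y))
      ≤⟨ ∑-mono (λ x → ∑-mono λ y →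
           when-modify (A x y) (edgeAdj F x y) (edgeAdj F′ x y) (F⊆A x y) (W′≤W x y)) ⟩
    (∑ λ x → ∑ λ y → when (A x y) (W x y) + when (edgeAdj F′ x y) (W′ x y))
      ≡⟨ ∑∑-+ (λ x y → when (A x y) (W x y)) (λ x y → when (edgeAdj F′ x y) (W′ x y)) ⟩
    weight A W + weight (edgeAdj F′) W′ ∎
    where open ≤-Reasoning

  incidence : Fin N → Fin N → Fin N → ℕ
  incidence z x _ = when ⌊ z ≟ x ⌋ 1

  deg≡weight : ∀ (A : Adj N) z → deg A z ≡ weight A (incidence z)
  deg≡weight A z = sym (trans (∑-cong row) (∑-single z (deg A)))
    where
    row : ∀ x → (∑ λ y → when (A x y) (when ⌊ z ≟ x ⌋ 1)) ≡ when ⌊ z ≟ x ⌋ (deg A x)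
    row x with ⌊ z ≟ x ⌋
    ... | true  = refl
    ... | false = trans (∑-cong (λ y → when-0 (A x y))) (∑-zero {N})

  deg-edgeAdj-≤ : ∀ L z → deg (edgeAdj L) z ≤ listWeight L (incidence z)
  deg-edgeAdj-≤ L z = ≤-trans (≤-reflexive (deg≡weight (edgeAdj L) z)) (weight-edgeAdj-≤ L (incidence z))

  incidence-∉ : ∀ (L : List (Edge N)) z → (∀ {e} → e ∈ L → z ≢ proj₁ e × z ≢ proj₂ e) →
                listWeight L (incidence z) ≡ 0
  incidence-∉ []            z _   = refl
  incidence-∉ ((p , q) ∷ L) z z∉ = cong₂ _+_
    (cong₂ _+_ (absent (proj₁ (z∉ (here refl)))) (absent (proj₂ (z∉ (here refl)))))
    (incidence-∉ L z (z∉ ∘ there))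
    where
    absent : ∀ {x} → z ≢ x → when ⌊ z ≟ x ⌋ 1 ≡ 0
    absent {x} z≢x = cong (λ b → when b 1) (⌊⌋-no (z ≟ x) z≢x)

  deg-modify : ∀ (A : Adj N) F F′ → edgeAdj F ⊆ A → Simple F → ∀ z →
               deg (modify A F F′) z + listWeight F (incidence z) ≤ deg A z + listWeight F′ (incidence z)
  deg-modify A F F′ F⊆A simple z = begin
    deg (modify A F F′) z + listWeight F (incidence z)
      ≡⟨ cong₂ _+_ (deg≡weight (modify A F F′) z) (sym (weight-edgeAdj F (incidence z) simple)) ⟩
    weight (modify A F F′) (incidence z) + weight (edgeAdj F) (incidence z)
      ≤⟨ weight-modify A F F′ F⊆A (λ _ _ → ≤-refl) ⟩
    weight A (incidence z) + weight (edgeAdj F′) (incidence z)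
      ≤⟨ +-mono-≤ (≤-reflexive (sym (deg≡weight A z))) (weight-edgeAdj-≤ F′ (incidence z)) ⟩
    deg A z + listWeight F′ (incidence z) ∎
    where open ≤-Reasoning

  ordered : (Fin N → Fin N → ℕ) → Fin N → Fin N → ℕ
  ordered f x y = when ⌊ x <? y ⌋ (f x y)

  ordered-≤ : ∀ f p q → f q p ≡ f p q → ordered f p q + ordered f q p ≤ f p q
  ordered-≤ f p q fqp≡fpq with p <? q | q <? p
  ... | yes p<q | yes q<p = ⊥-elim (<-asym p<q q<p)
  ... | yes _   | no _    = ≤-reflexive (+-identityʳ _)
  ... | no _    | yes _   = ≤-reflexive fqp≡fpq
  ... | no _    | no _    = z≤n

  ordered-≡ : ∀ f {p q} → f q p ≡ f p q → p ≢ q → ordered f p q + ordered f q p ≡ f p q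
  ordered-≡ f {p} {q} fqp≡fpq p≢q with p <? q | q <? p
  ... | yes p<q | yes q<p = ⊥-elim (<-asym p<q q<p)
  ... | yes _   | no _    = +-identityʳ _
  ... | no _    | yes _   = fqp≡fpq
  ... | no p≮q  | no q≮p  = ⊥-elim (p≢q (toℕ-injective (≤-antisym (≮⇒≥ q≮p) (≮⇒≥ p≮q))))

  listWeight-ordered-≤ : ∀ L f → (∀ p q → f q p ≡ f p q) → listWeight L (ordered f) ≤ sum (map (uncurry f) L)
  listWeight-ordered-≤ L f f-sym = sum-map-mono L (λ (p , q) → ordered-≤ f p q (f-sym p q))

  listWeight-ordered : ∀ L f → (∀ p q → f q p ≡ f p q) → Simple L → listWeight L (ordered f) ≡ sum (map (uncurry f) L)
  listWeight-ordered []            f f-sym _                 = refl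
  listWeight-ordered ((p , q) ∷ L) f f-sym (p≢q , _ , simple) =
    cong₂ _+_ (ordered-≡ f (f-sym p q) p≢q) (listWeight-ordered L f f-sym simple)

  M₂≡weight : ∀ (A : Adj N) → M₂ A ≡ weight A (ordered (λ x y → deg A x * deg A y))
  M₂≡weight A = ∑-cong λ x → ∑-cong λ y → when-∧ (A x y) ⌊ x <? y ⌋ (deg A x * deg A y)

  M₂-modify : ∀ (A : Adj N) F F′ → edgeAdj F ⊆ A → Simple F →
              (∀ z → deg (modify A F F′) z ≤ deg A z) →
              M₂ (modify A F F′) + sum (map (uncurry λ p q → deg A p * deg A q) F)
                ≤ M₂ A + sum (map (uncurry λ p q → deg (modify A F F′) p * deg (modify A F F′) q) F′)
  M₂-modify A F F′ F⊆A simple B≤A = begin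
    M₂ B + sum (map (uncurry dA²) F)
      ≡⟨ cong₂ _+_ (M₂≡weight B) (sym (trans (weight-edgeAdj F (ordered dA²) simple)
                                             (listWeight-ordered F dA² (λ p q → *-comm (deg A q) (deg A p)) simple))) ⟩
    weight B (ordered dB²) + weight (edgeAdj F) (ordered dA²)
      ≤⟨ weight-modify A F F′ F⊆A (λ x y → when-mono ⌊ x <? y ⌋ (*-mono-≤ (B≤A x) (B≤A y))) ⟩
    weight A (ordered dA²) + weight (edgeAdj F′) (ordered dB²)
      ≤⟨ +-mono-≤ (≤-reflexive (sym (M₂≡weight A)))
                  (≤-trans (weight-edgeAdj-≤ F′ (ordered dB²))
                           (listWeight-ordered-≤ F′ dB² (λ p q → *-comm (deg B q) (deg B p)))) ⟩
    M₂ A + sum (map (uncurry dB²) F′) ∎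
    where
    open ≤-Reasoning
    B : Adj N
    B = modify A F F′
    dA² dB² : Fin N → Fin N → ℕ
    dA² p q = deg A p * deg A q
    dB² p q = deg B p * deg B q

∑-square-< : ∀ {N} {f g : Fin N → ℕ} z → (∀ x → f x + when ⌊ x ≟ z ⌋ 1 ≤ g x) →
             ∑ (λ x → f x * f x) < ∑ (λ x → g x * g x)
∑-square-< {N} {f} {g} z f+δ≤g = begin-strict
  ∑ (λ x → f x * f x)                            <⟨ n<1+n _ ⟩
  suc (∑ λ x → f x * f x)                        ≡⟨ +-comm 1 _ ⟩
  (∑ λ x → f x * f x) + 1                        ≡⟨ cong (_ +_) one ⟨
  (∑ λ x → f x * f x) + (∑ λ x → when ⌊ x ≟ z ⌋ 1) ≡⟨ ∑-+ (λ x → f x * f x) (λ x → when ⌊ x ≟ z ⌋ 1) ⟨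
  (∑ λ x → f x * f x + when ⌊ x ≟ z ⌋ 1)          ≤⟨ ∑-mono (λ x → square-+when ⌊ x ≟ z ⌋ (f+δ≤g x)) ⟩
  (∑ λ x → g x * g x)                            ∎
  where
  open ≤-Reasoning
  one : (∑ λ x → when ⌊ x ≟ z ⌋ 1) ≡ 1
  one = trans (∑-cong (λ x → cong (λ b → when b 1) (≟-sym x z))) (∑-single z (λ _ → 1))

2≤deg : ∀ {N} (A : Adj N) {z a b} → a ≢ b → A z a ≡ true → A z b ≡ true → 2 ≤ deg A z
2≤deg {N} A {z} {a} {b} a≢b Aza Azb = begin
  2                                                    ≡⟨ cong₂ _+_ (∑-single a (λ _ → 1)) (∑-single b (λ _ → 1)) ⟨
  (∑ λ y → when ⌊ a ≟ y ⌋ 1) + (∑ λ y → when ⌊ b ≟ y ⌋ 1) ≡⟨ ∑-+ (λ y → when ⌊ a ≟ y ⌋ 1) (λ y → when ⌊ b ≟ y ⌋ 1) ⟨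
  (∑ λ y → when ⌊ a ≟ y ⌋ 1 + when ⌊ b ≟ y ⌋ 1)          ≤⟨ ∑-mono neighbour ⟩
  deg A z                                              ∎
  where
  open ≤-Reasoning
  neighbour : ∀ y → when ⌊ a ≟ y ⌋ 1 + when ⌊ b ≟ y ⌋ 1 ≤ when (A z y) 1
  neighbour y with a ≟ y | b ≟ y
  ... | yes refl | yes refl = ⊥-elim (a≢b refl)
  ... | yes refl | no _     = ≤-reflexive (cong (λ t → when t 1) (sym Aza))
  ... | no _     | yes refl = ≤-reflexive (cong (λ t → when t 1) (sym Azb))
  ... | no _     | no _     = z≤n

last-or-inject₁ : ∀ {m} (i : Fin (suc m)) → i ≡ fromℕ m ⊎ ∃ λ i′ → i ≡ inject₁ i′
last-or-inject₁ {zero}  zero    = inj₁ refl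
last-or-inject₁ {suc m} zero    = inj₂ (zero , refl)
last-or-inject₁ {suc m} (suc i) with last-or-inject₁ i
... | inj₁ refl       = inj₁ refl
... | inj₂ (i′ , refl) = inj₂ (suc i′ , refl)

inject₁≢suc : ∀ {m} (i : Fin m) → inject₁ i ≢ suc i
inject₁≢suc i eq = 1+n≢n (sym (trans (sym (toℕ-inject₁ i)) (cong toℕ eq)))

module Cycle {N k : ℕ} (f : Fin (3 + k) → Fin N) (f-injective : ∀ {i j} → f i ≡ f j → i ≡ j) where

  C : List (Edge N)
  C = cycleEdges {N} {2 + k} f

  wrap∈C : (f (fromℕ (2 + k)) , f zero) ∈ C
  wrap∈C = here refl

  step∈C : ∀ i → (f (inject₁ i) , f (suc i)) ∈ C
  step∈C i = there (∈-map⁺ (λ i → f (inject₁ i) , f (suc i)) (∈-allFin i))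

  ∈C⁻ : ∀ {e} → e ∈ C → ∃₂ λ i j → i ≢ j × e ≡ (f i , f j)
  ∈C⁻ (here refl) = fromℕ (2 + k) , zero , (λ ()) , refl
  ∈C⁻ (there e∈)  with ∈-map⁻ (λ i → f (inject₁ i) , f (suc i)) e∈
  ... | i , _ , refl = inject₁ i , suc i , inject₁≢suc i , refl

  C-adjacent : ∀ {x y} → edgeAdj C x y ≡ true → ∃₂ λ i j → i ≢ j × x ≡ f i × y ≡ f j
  C-adjacent Cxy with find (edgeAdj⁻ C Cxy)
  ... | e , e∈ , joins with ∈C⁻ e∈
  ... | i , j , i≢j , refl with joins
  ...   | inj₁ (fi≡x , fj≡y) = i , j , i≢j , sym fi≡x , sym fj≡y
  ...   | inj₂ (fi≡y , fj≡x) = j , i , i≢j ∘ sym , sym fj≡x , sym fi≡y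

  neighbours : ∀ i → ∃₂ λ j j′ → j ≢ j′ × Any (λ e → Joins e (f i) (f j)) C × Any (λ e → Joins e (f i) (f j′)) C
  neighbours zero = suc zero , fromℕ (2 + k) , (λ ()) ,
    lose (step∈C zero) (inj₁ (refl , refl)) , lose wrap∈C (inj₂ (refl , refl))
  neighbours (suc i) with last-or-inject₁ i
  ... | inj₁ refl = inject₁ i , zero , (λ ()) ,
    lose (step∈C i) (inj₂ (refl , refl)) , lose wrap∈C (inj₁ (refl , refl))
  ... | inj₂ (i′ , refl) = inject₁ i , suc (suc i′) , inject₁²≢suc² ,
    lose (step∈C i) (inj₂ (refl , refl)) , lose (step∈C (suc i′)) (inj₁ (refl , refl))
    where
    inject₁²≢suc² : inject₁ (inject₁ i′) ≢ suc (suc i′)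
    inject₁²≢suc² eq = m≢1+n+m (toℕ i′) {1}
      (trans (sym (trans (toℕ-inject₁ (inject₁ i′)) (toℕ-inject₁ i′))) (cong toℕ eq))

  incidence-C : ∀ i → listWeight C (incidence (f i)) ≡ 2
  incidence-C i = begin
    listWeight C (incidence (f i))
      ≡⟨ cong (δf (fromℕ (2 + k)) + δf zero +_) (cong sum (sym (map-∘ {g = term} {f = stepEdge} (allFin (2 + k))))) ⟩
    δf (fromℕ (2 + k)) + δf zero + (∑ λ j → δf (inject₁ j) + δf (suc j))
      ≡⟨ cong₂ _+_ (cong₂ _+_ (δf≡δ (fromℕ (2 + k))) (δf≡δ zero))
                   (∑-cong (λ j → cong₂ _+_ (δf≡δ (inject₁ j)) (δf≡δ (suc j)))) ⟩
    δ (fromℕ (2 + k)) + δ zero + (∑ λ j → δ (inject₁ j) + δ (suc j))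
      ≡⟨ cong (δ (fromℕ (2 + k)) + δ zero +_) (∑-+ (δ ∘ inject₁) (δ ∘ suc)) ⟩
    δ (fromℕ (2 + k)) + δ zero + (∑ (δ ∘ inject₁) + ∑ (δ ∘ suc))
      ≡⟨ interchange (δ (fromℕ (2 + k))) (δ zero) (∑ (δ ∘ inject₁)) (∑ (δ ∘ suc)) ⟩
    δ (fromℕ (2 + k)) + ∑ (δ ∘ inject₁) + (δ zero + ∑ (δ ∘ suc))
      ≡⟨ cong₂ _+_ (trans (+-comm (δ (fromℕ (2 + k))) (∑ (δ ∘ inject₁))) (sym (∑-init-last δ))) (sym (∑-suc δ)) ⟩
    ∑ δ + ∑ δ
      ≡⟨ cong₂ _+_ (∑-single i (λ _ → 1)) (∑-single i (λ _ → 1)) ⟩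
    2 ∎
    where
    open ≡-Reasoning
    stepEdge : Fin (2 + k) → Edge N
    stepEdge j = f (inject₁ j) , f (suc j)
    term : Edge N → ℕ
    term e = incidence (f i) (proj₁ e) (proj₂ e) + incidence (f i) (proj₂ e) (proj₁ e)
    δf : Fin (3 + k) → ℕ
    δf j = when ⌊ f i ≟ f j ⌋ 1
    δ : Fin (3 + k) → ℕ
    δ j = when ⌊ i ≟ j ⌋ 1
    δf≡δ : ∀ j → δf j ≡ δ j
    δf≡δ j with i ≟ j
    ... | yes refl = cong (λ b → when b 1) (⌊⌋-yes (f i ≟ f i) refl)
    ... | no i≢j   = cong (λ b → when b 1) (⌊⌋-no (f i ≟ f j) (i≢j ∘ f-injective))

↑ˡ≢↑ʳ : ∀ {m n} (i : Fin m) (j : Fin n) → i ↑ˡ n ≢ m ↑ʳ j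
↑ˡ≢↑ʳ {m} {n} i j eq with trans (sym (splitAt-↑ˡ m i n)) (trans (cong (splitAt m) eq) (splitAt-↑ʳ m n j))
... | ()

sum≤product : ∀ {x y} → 2 ≤ x → 2 ≤ y → x * 2 + (y * 2 + 0) ≤ x * y + 4
sum≤product {suc (suc i)} {suc (suc j)} (s≤s (s≤s _)) (s≤s (s≤s _)) = m+n≤o⇒m≤o _ (≤-reflexive (identity i j))
  where
  identity : ∀ i j → (2 + i) * 2 + ((2 + j) * 2 + 0) + i * j ≡ (2 + i) * (2 + j) + 4
  identity = solve-∀

M₂-arith : ∀ {X Y p q x y x′ y′ r₀ r₁} → 4 ≤ p → 4 ≤ q → 2 ≤ x → 2 ≤ y →
           x′ ≤ x → y′ ≤ y → r₀ ≤ 2 → r₁ ≤ 2 →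
           X + (p + (q + (x * y + 0))) ≤ Y + (x′ * r₀ + (y′ * r₁ + 0)) → X < Y
M₂-arith {X} {Y} {p} {q} {x} {y} {x′} {y′} {r₀} {r₁} 4≤p 4≤q 2≤x 2≤y x′≤x y′≤y r₀≤2 r₁≤2 h =
  +-cancelʳ-≤ (x * y + 4) (suc X) Y (begin
    suc X + (x * y + 4)           ≡⟨ shuffle X (x * y) ⟩
    X + (1 + (4 + (x * y + 0)))   ≤⟨ +-monoʳ-≤ X (+-mono-≤ (≤-trans (s≤s z≤n) 4≤p) (+-monoˡ-≤ (x * y + 0) 4≤q)) ⟩
    X + (p + (q + (x * y + 0)))   ≤⟨ h ⟩
    Y + (x′ * r₀ + (y′ * r₁ + 0)) ≤⟨ +-monoʳ-≤ Y (+-mono-≤ (*-mono-≤ x′≤x r₀≤2) (+-monoˡ-≤ 0 (*-mono-≤ y′≤y r₁≤2))) ⟩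
    Y + (x * 2 + (y * 2 + 0))     ≤⟨ +-monoʳ-≤ Y (sum≤product 2≤x 2≤y) ⟩
    Y + (x * y + 4)               ∎)
  where
  open ≤-Reasoning
  shuffle : ∀ X s → suc X + (s + 4) ≡ X + (1 + (4 + (s + 0)))
  shuffle = solve-∀

module Switching {n : ℕ} (G₀ : Graph n) (u w : Fin n) (u≢w : u ≢ w) (a b : ℕ) where
  open Construction G₀ u w a b

  g-injective : ∀ {i j} → g i ≡ g j → i ≡ j
  g-injective = ↑ˡ-injective _ _ _

  c₁-injective : ∀ {i j} → c₁ i ≡ c₁ j → i ≡ j
  c₁-injective = ↑ˡ-injective (2 + b) _ _ ∘ ↑ʳ-injective n _ _

  c₂-injective : ∀ {i j} → c₂ i ≡ c₂ j → i ≡ j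
  c₂-injective = ↑ʳ-injective (2 + a) _ _ ∘ ↑ʳ-injective n _ _

  g≢c₁ : ∀ i j → g i ≢ c₁ j
  g≢c₁ i j = ↑ˡ≢↑ʳ i _

  g≢c₂ : ∀ i j → g i ≢ c₂ j
  g≢c₂ i j = ↑ˡ≢↑ʳ i _

  c₁≢c₂ : ∀ i j → c₁ i ≢ c₂ j
  c₁≢c₂ i j = ↑ˡ≢↑ʳ i j ∘ ↑ʳ-injective n _ _

  p₁≢c₂ : ∀ i j → p₁ i ≢ c₂ j
  p₁≢c₂ zero    j = g≢c₂ u j
  p₁≢c₂ (suc i) j = c₁≢c₂ i j

  p₁≢gw : ∀ i → p₁ i ≢ g w
  p₁≢gw zero    = u≢w ∘ g-injective
  p₁≢gw (suc i) = g≢c₁ w i ∘ sym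

  p₁-injective : ∀ {i j} → p₁ i ≡ p₁ j → i ≡ j
  p₁-injective {zero}  {zero}  _  = refl
  p₁-injective {zero}  {suc j} eq with () ← g≢c₁ u j eq
  p₁-injective {suc i} {zero}  eq with () ← g≢c₁ u i (sym eq)
  p₁-injective {suc i} {suc j} eq = cong suc (c₁-injective eq)

  p₂-injective : ∀ {i j} → p₂ i ≡ p₂ j → i ≡ j
  p₂-injective {zero}  {zero}  _  = refl
  p₂-injective {zero}  {suc j} eq with () ← g≢c₂ w j eq
  p₂-injective {suc i} {zero}  eq with () ← g≢c₂ w i (sym eq)
  p₂-injective {suc i} {suc j} eq = cong suc (c₂-injective eq)

  module C₁ = Cycle p₁ p₁-injective
  module C₂ = Cycle p₂ p₂-injective

  E : List (Edge N)
  E = G₀edges ++ C₁edges ++ C₂edges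

  ∈G₀edges⁻ : ∀ {e} → e ∈ G₀edges → ∃₂ λ i j → e ≡ (g i , g j)
  ∈G₀edges⁻ e∈ with satisfied (∈-concatMap⁻ _ {xs = allFin n} e∈)
  ... | i , e∈row with satisfied (∈-concatMap⁻ _ {xs = allFin n} e∈row)
  ... | j , e∈ij with adj G₀ i j | e∈ij
  ... | true  | here refl = i , j , refl
  ... | false | ()

  C₁-edge⇒H₅ : ∀ {x y} → Any (λ e → Joins e x y) C₁edges → H₅ x y ≡ true
  C₁-edge⇒H₅ = edgeAdj⁺ E ∘ ++⁺ʳ G₀edges ∘ ++⁺ˡ

  C₂-edge⇒H₅ : ∀ {x y} → Any (λ e → Joins e x y) C₂edges → H₅ x y ≡ true
  C₂-edge⇒H₅ = edgeAdj⁺ E ∘ ++⁺ʳ G₀edges ∘ ++⁺ʳ C₁edges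

  2≤deg-p₁ : ∀ i → 2 ≤ deg H₅ (p₁ i)
  2≤deg-p₁ i with C₁.neighbours i
  ... | j , j′ , j≢j′ , ij , ij′ = 2≤deg H₅ (j≢j′ ∘ p₁-injective) (C₁-edge⇒H₅ ij) (C₁-edge⇒H₅ ij′)

  2≤deg-p₂ : ∀ i → 2 ≤ deg H₅ (p₂ i)
  2≤deg-p₂ i with C₂.neighbours i
  ... | j , j′ , j≢j′ , ij , ij′ = 2≤deg H₅ (j≢j′ ∘ p₂-injective) (C₂-edge⇒H₅ ij) (C₂-edge⇒H₅ ij′)

  deg-c₂≤2 : ∀ j → deg H₅ (c₂ j) ≤ 2
  deg-c₂≤2 j = begin
    deg H₅ (c₂ j)
      ≤⟨ deg-edgeAdj-≤ E (c₂ j) ⟩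
    listWeight E ι
      ≡⟨ trans (listWeight-++ G₀edges _ ι) (cong (listWeight G₀edges ι +_) (listWeight-++ C₁edges C₂edges ι)) ⟩
    listWeight G₀edges ι + (listWeight C₁edges ι + listWeight C₂edges ι)
      ≡⟨ cong₂ _+_ (incidence-∉ G₀edges (c₂ j) ∉G₀)
                   (cong₂ _+_ (incidence-∉ C₁edges (c₂ j) ∉C₁) (C₂.incidence-C (suc j))) ⟩
    2 ∎
    where
    ι : Fin N → Fin N → ℕ
    ι = incidence (c₂ j)
    open ≤-Reasoning
    ∉G₀ : ∀ {e} → e ∈ G₀edges → c₂ j ≢ proj₁ e × c₂ j ≢ proj₂ e
    ∉G₀ e∈ with ∈G₀edges⁻ e∈
    ... | i , i′ , refl = g≢c₂ i j ∘ sym , g≢c₂ i′ j ∘ sym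
    ∉C₁ : ∀ {e} → e ∈ C₁edges → c₂ j ≢ proj₁ e × c₂ j ≢ proj₂ e
    ∉C₁ e∈ with C₁.∈C⁻ e∈
    ... | i , i′ , _ , refl = p₁≢c₂ i j ∘ sym , p₁≢c₂ i′ j ∘ sym

  v₀≢v₂ : v₀ ≢ v₂
  v₀≢v₂ eq = fromℕ≢inject₁ (sym (p₂-injective {inject₁ (fromℕ (1 + b))} {fromℕ (2 + b)} eq))

  module Switch {i j : Fin (3 + a)} (i≢j : i ≢ j) (C₁ij : edgeAdj C₁edges (p₁ i) (p₁ j) ≡ true) where

    F F′ : List (Edge N)
    F  = (v₁ , g w) ∷ (v₀ , v₂) ∷ (p₁ i , p₁ j) ∷ []
    F′ = (p₁ i , v₀) ∷ (p₁ j , v₁) ∷ []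

    H : Adj N
    H = H₆ (p₁ i) (p₁ j)

    F⊆H₅ : edgeAdj F ⊆ H₅
    F⊆H₅ = edgeAdj-⊆ F (edgeAdj-sym E)
      ( C₂-edge⇒H₅ (lose (C₂.step∈C zero) (inj₂ (refl , refl)))
      ∷ C₂-edge⇒H₅ (lose (C₂.step∈C (fromℕ (1 + b))) (inj₁ (refl , refl)))
      ∷ C₁-edge⇒H₅ (edgeAdj⁻ C₁edges C₁ij)
      ∷ [])

    F-simple : Simple F
    F-simple = g≢c₂ w zero ∘ sym
             , ¬Joins (g≢c₂ w _ ∘ sym) (g≢c₂ w _ ∘ sym) ∷ ¬Joins (p₁≢gw i) (p₁≢gw j) ∷ []
             , v₀≢v₂
             , ¬Joins (p₁≢c₂ i _) (p₁≢c₂ j _) ∷ []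
             , i≢j ∘ p₁-injective
             , []
             , tt

    deg-drop : ∀ z → deg H z + when ⌊ z ≟ g w ⌋ 1 ≤ deg H₅ z
    deg-drop z = cancel (deg H z) (deg H₅ z) (I v₁) (I (g w)) (I v₀) (I v₂) (I (p₁ i)) (I (p₁ j))
                        (deg-modify H₅ F F′ F⊆H₅ F-simple z)
      where
      I : Fin N → ℕ
      I x = when ⌊ z ≟ x ⌋ 1
      cancel : ∀ d′ d iv₁ iw iv₀ iv₂ iu₁ iu₂ →
               d′ + (iv₁ + iw + (iv₀ + iv₂ + (iu₁ + iu₂ + 0))) ≤ d + (iu₁ + iv₀ + (iu₂ + iv₁ + 0)) →
               d′ + iw ≤ d
      cancel d′ d iv₁ iw iv₀ iv₂ iu₁ iu₂ h =
        m+n≤o⇒m≤o (d′ + iw)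
          (+-cancelʳ-≤ R (d′ + iw + iv₂) d (subst (_≤ d + R) (shuffle d′ iv₁ iw iv₀ iv₂ iu₁ iu₂) h))
        where
        R = iu₁ + iv₀ + (iu₂ + iv₁ + 0)
        shuffle : ∀ d′ iv₁ iw iv₀ iv₂ iu₁ iu₂ →
                  d′ + (iv₁ + iw + (iv₀ + iv₂ + (iu₁ + iu₂ + 0))) ≡ d′ + iw + iv₂ + (iu₁ + iv₀ + (iu₂ + iv₁ + 0))
        shuffle = solve-∀

    deg-≤ : ∀ z → deg H z ≤ deg H₅ z
    deg-≤ z = m+n≤o⇒m≤o (deg H z) (deg-drop z)

    M₁-drop : M₁ H < M₁ H₅
    M₁-drop = ∑-square-< (g w) deg-drop

    M₂-drop : M₂ H < M₂ H₅
    M₂-drop = M₂-arith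
      (*-mono-≤ (2≤deg-p₂ (suc zero)) (2≤deg-p₂ zero))
      (*-mono-≤ (2≤deg-p₂ (inject₁ (fromℕ (1 + b)))) (2≤deg-p₂ (fromℕ (2 + b))))
      (2≤deg-p₁ i) (2≤deg-p₁ j) (deg-≤ (p₁ i)) (deg-≤ (p₁ j))
      (≤-trans (deg-≤ v₀) (deg-c₂≤2 (inject₁ (fromℕ b))))
      (≤-trans (deg-≤ v₁) (deg-c₂≤2 zero))
      (M₂-modify H₅ F F′ F⊆H₅ F-simple deg-≤)

  zagreb-drop : ∀ u₁ u₂ → edgeAdj C₁edges u₁ u₂ ≡ true →
                (M₁ (H₆ u₁ u₂) < M₁ H₅) × (M₂ (H₆ u₁ u₂) < M₂ H₅)
  zagreb-drop u₁ u₂ C₁u₁u₂ with C₁.C-adjacent C₁u₁u₂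
  ... | i , j , i≢j , refl , refl = Switch.M₁-drop i≢j C₁u₁u₂ , Switch.M₂-drop i≢j C₁u₁u₂

lemma2p5 : (n : ℕ) (G₀ : Graph n) → 2 ≤ n → Connected G₀ →
    (u w : Fin n) → u ≢ w → (a b : ℕ) →
    let open Construction G₀ u w a b in
    (u₁ u₂ : Fin N) → edgeAdj C₁edges u₁ u₂ ≡ true →
    (M₁ (H₆ u₁ u₂) < M₁ H₅) × (M₂ (H₆ u₁ u₂) < M₂ H₅)
lemma2p5 n G₀ _ _ u w u≢w a b = Switching.zagreb-drop G₀ u w u≢w a b
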